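{- Let $\mathbb{F}$ be a field and let $\mathbf{x}=(\mathbf{x}_1,\ldots,\mathbf{x}_d)$ be $nd$ variables partitioned into $d$ sets $\mathbf{x}_i$ of $n$ variables each. Let $S_f\sqcup S_g=[d]$ with $|S_f|=d_f$, $|S_g|=d_g$. Let $\mathbf{f}(\mathbf{x}),\mathbf{g}(\mathbf{x})\in\mathbb{F}[\mathbf{x}]^m$ be vectors such that every entry of $\mathbf{f}$ is homogeneous set-multilinear with respect to $(\mathbf{x}_i)_{i\in S_f}$ and every entry of $\mathbf{g}$ is homogeneous set-multilinear with respect to $(\mathbf{x}_i)_{i\in S_g}$. Then $$\mathrm{rank}(\mathcal{C}(\mathbf{f}(\mathbf{x})\otimes\mathbf{g}(\mathbf{x})))\le\min\{n^{d_f},n^{d_g}\}.$$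
   Context: A polynomial is homogeneous set-multilinear with respect to $(\mathbf{x}_i)_{i\in S}$ if every monomial in it has degree $|S|$ and contains exactly one variable from each $\mathbf{x}_i$, $i\in S$. $\mathbf{f}\otimes\mathbf{g}$ is the $m\times m$ polynomial matrix with $(i,j)$ entry $f_ig_j$. For a polynomial matrix $M(\mathbf{x})=\sum_{\mathbf{e}}M_{\mathbf{e}}\mathbf{x}^{\mathbf{e}}$ expanded in the monomial basis with $M_{\mathbf{e}}\in\mathbb{F}^{m\times m}$, the coefficient space is $\mathcal{C}(M(\mathbf{x}))=\mathrm{span}\{M_{\mathbf{e}}\}$. For a set $\mathcal{M}$ of matrices, $\mathrm{rank}(\mathcal{M})=\max_{M\in\mathcal{M}}\mathrm{rank}(M)$. -}

module Defs where

open import Level using (_⊔_; suc)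
open import Algebra.Bundles using (CommutativeRing)
open import Data.Nat as ℕ using (ℕ)
open import Data.Fin using (Fin)
open import Data.Fin.Subset using (Subset; _∈_; ∣_∣)
open import Data.Vec using (Vec; lookup; zipWith)
import Data.Vec.Properties as VecP
open import Data.List as List using (List; []; _∷_; concatMap; map)
open import Data.Nat.ListAction renaming (sum to sumℕ)
open import Data.Product using (Σ; ∃; _×_; _,_)
open import Relation.Nullary using (¬_; yes; no)
open import Relation.Binary.PropositionalEquality using (_≡_)

record Field c ℓ : Set (Level.suc (c ⊔ ℓ)) where
  field
    commutativeRing : CommutativeRing c ℓ
  open CommutativeRing commutativeRing public
  field
    0≉1     : ¬ (0# ≈ 1#)
    inverse : ∀ x → ¬ (x ≈ 0#) → ∃ λ y → x * y ≈ 1#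

-- Monomials in the variables x = (x_1,…,x_d), each block x_i having n
-- variables x_{i,1},…,x_{i,n}: an exponent vector e, where
-- lookup (lookup e i) k is the exponent of x_{i,k}.

Mono : ℕ → ℕ → Set
Mono d n = Vec (Vec ℕ n) d

_·ₘ_ : ∀ {d n} → Mono d n → Mono d n → Mono d n
e ·ₘ e′ = zipWith (zipWith ℕ._+_) e e′

blockDeg : ∀ {d n} → Mono d n → Fin d → ℕ
blockDeg e i = sumℕ (Data.Vec.toList (lookup e i))
  where import Data.Vec

degree : ∀ {d n} → Mono d n → ℕ
degree {d} e = sumℕ (Data.Vec.toList (Data.Vec.map (λ v → sumℕ (Data.Vec.toList v)) e))
  where import Data.Vec

SetMultilinearMono : ∀ {d n} → Subset d → Mono d n → Set
SetMultilinearMono S e = degree e ≡ ∣ S ∣ × (∀ i → i ∈ S → blockDeg e i ≡ 1)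

_≟ₘ_ : ∀ {d n} (e e′ : Mono d n) → Relation.Nullary.Dec (e ≡ e′)
_≟ₘ_ = VecP.≡-dec (VecP.≡-dec ℕ._≟_)

module _ {c ℓ} (F : Field c ℓ) where
  open Field F

  -- A polynomial in F[x] given as a finite list of terms (coefficient, monomial);
  -- its coefficient at a monomial e is the sum of the coefficients of the
  -- terms with monomial e.
  Poly : ℕ → ℕ → Set c
  Poly d n = List (Carrier × Mono d n)

  coeff : ∀ {d n} → Poly d n → Mono d n → Carrier
  coeff [] e = 0#
  coeff ((a , e′) ∷ p) e with e ≟ₘ e′
  ... | yes _ = a + coeff p e
  ... | no  _ = coeff p e

  _·ₚ_ : ∀ {d n} → Poly d n → Poly d n → Poly d n
  p ·ₚ q = concatMap (λ { (a , e) → map (λ { (b , e′) → (a * b , e ·ₘ e′) }) q }) p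

  HomSetMultilinear : ∀ {d n} → Subset d → Poly d n → Set ℓ
  HomSetMultilinear S p = ∀ e → ¬ (coeff p e ≈ 0#) → SetMultilinearMono S e

  Matrix : ℕ → Set c
  Matrix m = Fin m → Fin m → Carrier

  _⊗_ : ∀ {d n m} → (Fin m → Poly d n) → (Fin m → Poly d n) → Fin m → Fin m → Poly d n
  (f ⊗ g) i j = f i ·ₚ g j

  coeffMatrix : ∀ {d n m} → (Fin m → Fin m → Poly d n) → Mono d n → Matrix m
  coeffMatrix M e i j = coeff (M i j) e

  ∑ : ∀ {k} → (Fin k → Carrier) → Carrier
  ∑ {ℕ.zero}  v = 0#
  ∑ {ℕ.suc k} v = v Fin.zero + ∑ (λ i → v (Fin.suc i))
    where import Data.Fin as Fin

  InCoeffSpace : ∀ {d n m} → (Fin m → Fin m → Poly d n) → Matrix m → Set (c ⊔ ℓ)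
  InCoeffSpace {d} {n} {m} M A =
    Σ (List (Carrier × Mono d n)) λ ts →
      ∀ i j → A i j ≈ List.foldr (λ { (a , e) s → a * coeffMatrix M e i j + s }) 0# ts

  LinIndep : ∀ {k m} → (Fin k → Fin m → Carrier) → Set (c ⊔ ℓ)
  LinIndep {k} {m} v =
    ∀ (λs : Fin k → Carrier) → (∀ i → ∑ (λ j → λs j * v j i) ≈ 0#) → ∀ j → λs j ≈ 0#

  RankLe : ∀ {m} → Matrix m → ℕ → Set (c ⊔ ℓ)
  RankLe {m} A r = ∀ (σ : Fin (ℕ.suc r) → Fin m) → ¬ LinIndep (λ j i → A i (σ j))

  -- rank(𝓜) ≤ r for the set 𝓜 = C(M(x)): max over 𝓜 of rank ≤ r
  CoeffSpaceRankLe : ∀ {d n m} → (Fin m → Fin m → Poly d n) → ℕ → Set (c ⊔ ℓ)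
  CoeffSpaceRankLe M r = ∀ A → InCoeffSpace M A → RankLe A r

-- A monomial e factors as a monomial on the blocks of Sf times one on the blocks of Sg in exactly
-- one way, e = eᶠ eᵍ, so the (i , j) coefficient of f ⊗ g at e is fᵢ[eᶠ] gⱼ[eᵍ]. Expanding
-- fᵢ[eᶠ] = Σₛ fᵢ[bₛ] [eᶠ = bₛ] over the n ^ ∣ Sf ∣ set-multilinear monomials bₛ on Sf shows that
-- every matrix Σₜ aₜ (f ⊗ g)ₑₜ of the coefficient space is a product P Q with inner dimension
-- n ^ ∣ Sf ∣, hence has rank at most n ^ ∣ Sf ∣ (more than N vectors in Fᴺ are dependent, by
-- Gaussian elimination); symmetrically for Sg.

module Submission where

open import Defs
open import Data.Nat using (ℕ; _^_; _⊓_)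
import Data.Nat as ℕ
open import Data.Fin using (Fin)
open import Data.Fin.Subset using (Subset; _∩_; _∪_; ⊥; ⊤; ∣_∣)
open import Relation.Binary.PropositionalEquality using (_≡_)

open import Data.Fin using (zero; suc; punchIn; punchOut)
open import Data.Fin.Properties using (punchInᵢ≢i; punchIn-punchOut) renaming (_≟_ to _≟ᶠ_)
open import Data.List using ([]; _∷_; _++_; map; foldr; length)
open import Data.Maybe using (Maybe; just; nothing; maybe′)
open import Data.Maybe.Properties using (just-injective) renaming (≡-dec to ≡-decᴹ)
open import Data.Nat.Induction using (<-wellFounded)
open import Data.Nat.Properties using (m≤n⇒m≤1+n; n≮n; ⊓-sel)
open import Data.Product using (_×_; _,_; proj₁; proj₂)
open import Data.Sum using (inj₁; inj₂)
open import Effect.Monad using (RawMonad)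
open import Function using (_⇔_; _∘_; _on_; Equivalence)
open import Induction.WellFounded using (Acc; acc)
open import Relation.Binary.Construct.On using (wellFounded)
open import Relation.Binary.PropositionalEquality as ≡ using (_≢_; refl; cong)
open import Relation.Nullary using (Dec; yes; no; ¬_)
open import Relation.Nullary.Decidable using (decidable-stable; ¬¬-excluded-middle)
open import Relation.Nullary.Negation using (contradiction; ¬¬-Monad)

module Monomials where

  open import Data.Bool using (true; false)
  open import Data.Fin using (zero; suc; combine; remQuot)
  open import Data.Fin.Properties using (remQuot-combine)
  open import Data.Fin.Subset using (_∈_)
  open import Data.Fin.Subset.Properties using (∩-comm)
  open import Data.Maybe using (Maybe; just; nothing)
  open import Data.Nat using (zero; suc; _+_) renaming (_≟_ to _≟ℕ_)
  open import Data.Nat.ListAction using () renaming (sum to sumℕ)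
  open import Data.Nat.Properties
    using (+-identityˡ; +-identityʳ; +-assoc; +-comm; +-cancelˡ-≡; suc-injective; m+n≡0⇒m≡0; m+n≡0⇒n≡0)
  open import Data.Product using (_×_; _,_; proj₁; proj₂)
  open import Data.Unit using (tt) renaming (⊤ to Unit)
  open import Data.Vec using (Vec; []; _∷_; replicate; zipWith; toList; here; there)
  open import Data.Vec.Properties using (∷-injectiveʳ; ≡-dec)
  open import Data.Vec.Relation.Binary.Pointwise.Inductive using (Pointwise-≡⇒≡; zipWith-identityˡ; zipWith-identityʳ)
  open import Function using (_⇔_; mk⇔; _∘_)
  open import Relation.Binary.PropositionalEquality using (refl; sym; trans; cong; cong₂; module ≡-Reasoning)
  open import Relation.Nullary using (Dec; yes; no; _×-dec_)

  private
    variable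
      d n : ℕ

  zeros : Vec ℕ n
  zeros {n} = replicate n 0

  1ₘ : Mono d n
  1ₘ {d} = replicate d zeros

  +ᵥ-identityˡ : (v : Vec ℕ n) → zipWith _+_ zeros v ≡ v
  +ᵥ-identityˡ v = Pointwise-≡⇒≡ (zipWith-identityˡ +-identityˡ v)

  +ᵥ-identityʳ : (v : Vec ℕ n) → zipWith _+_ v zeros ≡ v
  +ᵥ-identityʳ v = Pointwise-≡⇒≡ (zipWith-identityʳ +-identityʳ v)

  ·ₘ-identityˡ : (e : Mono d n) → 1ₘ ·ₘ e ≡ e
  ·ₘ-identityˡ e = Pointwise-≡⇒≡ (zipWith-identityˡ +ᵥ-identityˡ e)

  ·ₘ-identityʳ : (e : Mono d n) → e ·ₘ 1ₘ ≡ e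
  ·ₘ-identityʳ e = Pointwise-≡⇒≡ (zipWith-identityʳ +ᵥ-identityʳ e)

  restrict : Subset d → Mono d n → Mono d n
  restrict []          []      = []
  restrict (true  ∷ S) (v ∷ e) = v ∷ restrict S e
  restrict (false ∷ S) (v ∷ e) = zeros ∷ restrict S e

  restrict-·ₘ : (S : Subset d) (e e′ : Mono d n) → restrict S (e ·ₘ e′) ≡ restrict S e ·ₘ restrict S e′
  restrict-·ₘ []          []      []        = refl
  restrict-·ₘ (true  ∷ S) (v ∷ e) (v′ ∷ e′) = cong (_ ∷_) (restrict-·ₘ S e e′)
  restrict-·ₘ (false ∷ S) (v ∷ e) (v′ ∷ e′) = cong₂ _∷_ (sym (+ᵥ-identityˡ zeros)) (restrict-·ₘ S e e′)

  restrict-disjoint : (S T : Subset d) → S ∩ T ≡ ⊥ → (e : Mono d n) → restrict S (restrict T e) ≡ 1ₘ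
  restrict-disjoint []          []          _   []      = refl
  restrict-disjoint (true  ∷ S) (true  ∷ T) () _
  restrict-disjoint (true  ∷ S) (false ∷ T) S∩T (v ∷ e) = cong (_ ∷_) (restrict-disjoint S T (∷-injectiveʳ S∩T) e)
  restrict-disjoint (false ∷ S) (true  ∷ T) S∩T (v ∷ e) = cong (_ ∷_) (restrict-disjoint S T (∷-injectiveʳ S∩T) e)
  restrict-disjoint (false ∷ S) (false ∷ T) S∩T (v ∷ e) = cong (_ ∷_) (restrict-disjoint S T (∷-injectiveʳ S∩T) e)

  restrict-cover : (S T : Subset d) → S ∩ T ≡ ⊥ → S ∪ T ≡ ⊤ → (e : Mono d n) → restrict S e ·ₘ restrict T e ≡ e
  restrict-cover []          []          _   _   []      = refl
  restrict-cover (true  ∷ S) (true  ∷ T) ()  _   _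
  restrict-cover (false ∷ S) (false ∷ T) _   ()  _
  restrict-cover (true  ∷ S) (false ∷ T) S∩T S∪T (v ∷ e) =
    cong₂ _∷_ (+ᵥ-identityʳ v) (restrict-cover S T (∷-injectiveʳ S∩T) (∷-injectiveʳ S∪T) e)
  restrict-cover (false ∷ S) (true  ∷ T) S∩T S∪T (v ∷ e) =
    cong₂ _∷_ (+ᵥ-identityˡ v) (restrict-cover S T (∷-injectiveʳ S∩T) (∷-injectiveʳ S∪T) e)

  ·ₘ-restrict-⇔ : {S T : Subset d} → S ∩ T ≡ ⊥ → S ∪ T ≡ ⊤ → {e e₁ e₂ : Mono d n} →
                  restrict S e₁ ≡ e₁ → restrict T e₂ ≡ e₂ →
                  e ≡ e₁ ·ₘ e₂ ⇔ (restrict S e ≡ e₁ × restrict T e ≡ e₂)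
  ·ₘ-restrict-⇔ {S = S} {T} S∩T≡⊥ S∪T≡⊤ {e} {e₁} {e₂} e₁-on-S e₂-on-T = mk⇔ split join
    where
    open ≡-Reasoning
    split : e ≡ e₁ ·ₘ e₂ → restrict S e ≡ e₁ × restrict T e ≡ e₂
    split refl = restrictS , restrictT
      where
      restrictS : restrict S (e₁ ·ₘ e₂) ≡ e₁
      restrictS = begin
        restrict S (e₁ ·ₘ e₂)                ≡⟨ restrict-·ₘ S e₁ e₂ ⟩
        restrict S e₁ ·ₘ restrict S e₂      ≡⟨ cong₂ _·ₘ_ e₁-on-S (cong (restrict S) (sym e₂-on-T)) ⟩
        e₁ ·ₘ restrict S (restrict T e₂)    ≡⟨ cong (e₁ ·ₘ_) (restrict-disjoint S T S∩T≡⊥ e₂) ⟩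
        e₁ ·ₘ 1ₘ                             ≡⟨ ·ₘ-identityʳ e₁ ⟩
        e₁                                   ∎
      restrictT : restrict T (e₁ ·ₘ e₂) ≡ e₂
      restrictT = begin
        restrict T (e₁ ·ₘ e₂)                ≡⟨ restrict-·ₘ T e₁ e₂ ⟩
        restrict T e₁ ·ₘ restrict T e₂      ≡⟨ cong₂ _·ₘ_ (cong (restrict T) (sym e₁-on-S)) e₂-on-T ⟩
        restrict T (restrict S e₁) ·ₘ e₂    ≡⟨ cong (_·ₘ e₂) (restrict-disjoint T S (trans (∩-comm T S) S∩T≡⊥) e₁) ⟩
        1ₘ ·ₘ e₂                             ≡⟨ ·ₘ-identityˡ e₂ ⟩
        e₂                                   ∎
    join : restrict S e ≡ e₁ × restrict T e ≡ e₂ → e ≡ e₁ ·ₘ e₂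
    join (refl , refl) = sym (restrict-cover S T S∩T≡⊥ S∪T≡⊤ e)

  degreeᵥ : Vec ℕ n → ℕ
  degreeᵥ v = sumℕ (toList v)

  degreeᵥ≡0⇒zeros : (v : Vec ℕ n) → degreeᵥ v ≡ 0 → v ≡ zeros
  degreeᵥ≡0⇒zeros []      _  = refl
  degreeᵥ≡0⇒zeros (x ∷ v) eq = cong₂ _∷_ (m+n≡0⇒m≡0 x eq) (degreeᵥ≡0⇒zeros v (m+n≡0⇒n≡0 x eq))

  -- Block-by-block form of SetMultilinearMono, which constrains the blocks outside S only through
  -- the total degree.
  SetMultilinear : Subset d → Mono d n → Set
  SetMultilinear []          []      = Unit
  SetMultilinear (true  ∷ S) (v ∷ e) = degreeᵥ v ≡ 1 × SetMultilinear S e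
  SetMultilinear (false ∷ S) (v ∷ e) = v ≡ zeros × SetMultilinear S e

  setMultilinear? : (S : Subset d) (e : Mono d n) → Dec (SetMultilinear S e)
  setMultilinear? []          []      = yes tt
  setMultilinear? (true  ∷ S) (v ∷ e) = (degreeᵥ v ≟ℕ 1) ×-dec setMultilinear? S e
  setMultilinear? (false ∷ S) (v ∷ e) = ≡-dec _≟ℕ_ v zeros ×-dec setMultilinear? S e

  SetMultilinear⇒restrict≡ : (S : Subset d) (e : Mono d n) → SetMultilinear S e → restrict S e ≡ e
  SetMultilinear⇒restrict≡ []          []      _           = refl
  SetMultilinear⇒restrict≡ (true  ∷ S) (v ∷ e) (_    , sm) = cong (v ∷_) (SetMultilinear⇒restrict≡ S e sm)
  SetMultilinear⇒restrict≡ (false ∷ S) (v ∷ e) (v≡0 , sm) = cong₂ _∷_ (sym v≡0) (SetMultilinear⇒restrict≡ S e sm)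

  outsideDegree : Subset d → Mono d n → ℕ
  outsideDegree []          []      = 0
  outsideDegree (true  ∷ S) (v ∷ e) = outsideDegree S e
  outsideDegree (false ∷ S) (v ∷ e) = degreeᵥ v + outsideDegree S e

  UnitBlocksOn : Subset d → Mono d n → Set
  UnitBlocksOn S e = ∀ i → i ∈ S → blockDeg e i ≡ 1

  unitBlocksOn-tail : ∀ {b} {S : Subset d} {v : Vec ℕ n} {e} → UnitBlocksOn (b ∷ S) (v ∷ e) → UnitBlocksOn S e
  unitBlocksOn-tail unit i i∈S = unit (suc i) (there i∈S)

  degree-outside : (S : Subset d) (e : Mono d n) → UnitBlocksOn S e → degree e ≡ ∣ S ∣ + outsideDegree S e
  degree-outside []          []      _    = refl
  degree-outside (true  ∷ S) (v ∷ e) unit =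
    cong₂ _+_ (unit zero here) (degree-outside S e (unitBlocksOn-tail unit))
  degree-outside (false ∷ S) (v ∷ e) unit = begin
    degreeᵥ v + degree e                     ≡⟨ cong (degreeᵥ v +_) (degree-outside S e (unitBlocksOn-tail unit)) ⟩
    degreeᵥ v + (∣ S ∣ + outsideDegree S e)  ≡⟨ sym (+-assoc (degreeᵥ v) _ _) ⟩
    degreeᵥ v + ∣ S ∣ + outsideDegree S e    ≡⟨ cong (_+ outsideDegree S e) (+-comm (degreeᵥ v) ∣ S ∣) ⟩
    ∣ S ∣ + degreeᵥ v + outsideDegree S e    ≡⟨ +-assoc ∣ S ∣ _ _ ⟩
    ∣ S ∣ + (degreeᵥ v + outsideDegree S e)  ∎
    where open ≡-Reasoning

  outsideDegree≡0⇒SetMultilinear : (S : Subset d) (e : Mono d n) → UnitBlocksOn S e → outsideDegree S e ≡ 0 →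
                                    SetMultilinear S e
  outsideDegree≡0⇒SetMultilinear []          []      _    _  = tt
  outsideDegree≡0⇒SetMultilinear (true  ∷ S) (v ∷ e) unit eq =
    unit zero here , outsideDegree≡0⇒SetMultilinear S e (unitBlocksOn-tail unit) eq
  outsideDegree≡0⇒SetMultilinear (false ∷ S) (v ∷ e) unit eq =
    degreeᵥ≡0⇒zeros v (m+n≡0⇒m≡0 (degreeᵥ v) eq) ,
    outsideDegree≡0⇒SetMultilinear S e (unitBlocksOn-tail unit) (m+n≡0⇒n≡0 (degreeᵥ v) eq)

  SetMultilinearMono⇒SetMultilinear : (S : Subset d) (e : Mono d n) → SetMultilinearMono S e → SetMultilinear S e
  SetMultilinearMono⇒SetMultilinear S e (deg≡∣S∣ , unit) = outsideDegree≡0⇒SetMultilinear S e unit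
    (+-cancelˡ-≡ ∣ S ∣ _ _ (trans (sym (degree-outside S e unit)) (trans deg≡∣S∣ (sym (+-identityʳ ∣ S ∣)))))

  unitVector : Fin n → Vec ℕ n
  unitVector zero    = 1 ∷ zeros
  unitVector (suc k) = 0 ∷ unitVector k

  position : (v : Vec ℕ n) → degreeᵥ v ≡ 1 → Fin n
  position (zero  ∷ v) deg≡1 = suc (position v deg≡1)
  position (suc _ ∷ _) _     = zero

  unitVector-position : (v : Vec ℕ n) (deg≡1 : degreeᵥ v ≡ 1) → unitVector (position v deg≡1) ≡ v
  unitVector-position (zero  ∷ v) deg≡1 = cong (0 ∷_) (unitVector-position v deg≡1)
  unitVector-position (suc x ∷ v) deg≡1 =
    cong₂ _∷_ (cong suc (sym (m+n≡0⇒m≡0 x rest≡0))) (sym (degreeᵥ≡0⇒zeros v (m+n≡0⇒n≡0 x rest≡0)))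
    where
    rest≡0 : x + degreeᵥ v ≡ 0
    rest≡0 = suc-injective deg≡1

  -- The n ^ ∣ S ∣ set-multilinear monomials on S, indexed by their base-n digit strings.
  basis : (S : Subset d) → Fin (n ^ ∣ S ∣) → Mono d n
  basis          []          _ = []
  basis {n = n} (true  ∷ S) s with remQuot {n} (n ^ ∣ S ∣) s
  ... | k , s′ = unitVector k ∷ basis S s′
  basis         (false ∷ S) s = zeros ∷ basis S s

  index : (S : Subset d) (e : Mono d n) → SetMultilinear S e → Fin (n ^ ∣ S ∣)
  index []          []      _             = zero
  index (true  ∷ S) (v ∷ e) (deg≡1 , sm) = combine (position v deg≡1) (index S e sm)
  index (false ∷ S) (v ∷ e) (_     , sm) = index S e sm

  basis-index : (S : Subset d) (e : Mono d n) (sm : SetMultilinear S e) → basis S (index S e sm) ≡ e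
  basis-index []          []      _             = refl
  basis-index {n = n} (true  ∷ S) (v ∷ e) (deg≡1 , sm) =
    cong₂ _∷_ (trans (cong (unitVector ∘ proj₁) split) (unitVector-position v deg≡1))
              (trans (cong (basis S ∘ proj₂) split) (basis-index S e sm))
    where
    split : remQuot (n ^ ∣ S ∣) (combine (position v deg≡1) (index S e sm)) ≡ (position v deg≡1 , index S e sm)
    split = remQuot-combine (position v deg≡1) (index S e sm)
  basis-index (false ∷ S) (v ∷ e) (v≡0 , sm) = cong₂ _∷_ (sym v≡0) (basis-index S e sm)

  coordinate : (S : Subset d) → Mono d n → Maybe (Fin (n ^ ∣ S ∣))
  coordinate S e with setMultilinear? S e
  ... | yes sm = just (index S e sm)
  ... | no  _  = nothing

open Monomials

¬¬-∀Fin : ∀ {a k} {P : Fin k → Set a} → (∀ i → ¬ ¬ P i) → ¬ ¬ (∀ i → P i)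
¬¬-∀Fin {k = ℕ.zero}  _ ¬∀ = ¬∀ λ ()
¬¬-∀Fin {k = ℕ.suc k} h ¬∀ = h zero λ p₀ → ¬¬-∀Fin (h ∘ suc) λ ps → ¬∀ λ { zero → p₀ ; (suc i) → ps i }

module _ {c ℓ} (F : Field c ℓ) where
  open Field F renaming (refl to ≈-refl; sym to ≈-sym; trans to ≈-trans) hiding (zero)
  open import Algebra.Properties.Semiring.Sum semiring
    using (sum; sum-cong-≋; sum-replicate-zero; sum-remove; ∑-distrib-+; ∑-comm; *-distribˡ-sum; *-distribʳ-sum)
  open import Algebra.Properties.CommutativeSemigroup *-commutativeSemigroup using (x∙yz≈y∙xz; x∙yz≈xz∙y)
  open import Algebra.Properties.CommutativeSemigroup +-commutativeSemigroup
    using () renaming (x∙yz≈y∙xz to x+[y+z]≈y+[x+z])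
  open import Algebra.Properties.Ring ring using (-‿distribˡ-*; -‿distribʳ-*)
  open RawMonad (¬¬-Monad {ℓ}) using (pure; _>>=_; _<$>_)
  open import Relation.Binary.Reasoning.Setoid setoid

  private
    variable
      d n k : ℕ

  sum-zero : {f : Fin k → Carrier} → (∀ i → f i ≈ 0#) → sum f ≈ 0#
  sum-zero {k} f≈0 = ≈-trans (sum-cong-≋ f≈0) (sum-replicate-zero k)

  ∑≈sum : (f : Fin k → Carrier) → ∑ F f ≈ sum f
  ∑≈sum {ℕ.zero}  f = ≈-refl
  ∑≈sum {ℕ.suc k} f = +-congˡ (∑≈sum (f ∘ suc))

  𝟙 : ∀ {a} {P : Set a} → Dec P → Carrier
  𝟙 (yes _) = 1#
  𝟙 (no  _) = 0#

  𝟙-yes : ∀ {a} {P : Set a} → P → (p? : Dec P) → 𝟙 p? ≈ 1#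
  𝟙-yes _ (yes _) = ≈-refl
  𝟙-yes p (no ¬p) = contradiction p ¬p

  𝟙-no : ∀ {a} {P : Set a} → ¬ P → (p? : Dec P) → 𝟙 p? ≈ 0#
  𝟙-no ¬p (yes p) = contradiction p ¬p
  𝟙-no _  (no _)  = ≈-refl

  𝟙-⇔× : ∀ {a b e} {P : Set a} {Q : Set b} {R : Set e} → P ⇔ (Q × R) →
         (p? : Dec P) (q? : Dec Q) (r? : Dec R) → 𝟙 p? ≈ 𝟙 q? * 𝟙 r?
  𝟙-⇔× P⇔Q×R p? (yes q) (yes r) = ≈-trans (𝟙-yes (Equivalence.from P⇔Q×R (q , r)) p?) (≈-sym (*-identityˡ 1#))
  𝟙-⇔× P⇔Q×R p? (no ¬q) r?      = ≈-trans (𝟙-no (¬q ∘ proj₁ ∘ Equivalence.to P⇔Q×R) p?) (≈-sym (zeroˡ (𝟙 r?)))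
  𝟙-⇔× P⇔Q×R p? (yes _) (no ¬r) = ≈-trans (𝟙-no (¬r ∘ proj₂ ∘ Equivalence.to P⇔Q×R) p?) (≈-sym (zeroʳ 1#))

  _≟ᴹ_ : (c c′ : Maybe (Fin k)) → Dec (c ≡ c′)
  _≟ᴹ_ = ≡-decᴹ _≟ᶠ_

  sum-𝟙-just : (u : Fin k → Carrier) (c : Maybe (Fin k)) → sum (λ s → u s * 𝟙 (c ≟ᴹ just s)) ≈ maybe′ u 0# c
  sum-𝟙-just u nothing  = sum-zero λ s → ≈-trans (*-congˡ (𝟙-no (λ ()) (nothing ≟ᴹ just s))) (zeroʳ (u s))
  sum-𝟙-just {ℕ.suc k} u (just t) = begin
    sum f                      ≈⟨ sum-remove {i = t} f ⟩
    f t + sum (f ∘ punchIn t)  ≈⟨ +-cong at-t (sum-zero elsewhere) ⟩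
    u t + 0#                   ≈⟨ +-identityʳ (u t) ⟩
    u t                        ∎
    where
    f : Fin (ℕ.suc k) → Carrier
    f s = u s * 𝟙 (just t ≟ᴹ just s)
    at-t : f t ≈ u t
    at-t = ≈-trans (*-congˡ (𝟙-yes refl (just t ≟ᴹ just t))) (*-identityʳ (u t))
    elsewhere : ∀ s → f (punchIn t s) ≈ 0#
    elsewhere s = ≈-trans (*-congˡ (𝟙-no (punchInᵢ≢i t s ∘ ≡.sym ∘ just-injective) (just t ≟ᴹ just (punchIn t s))))
                          (zeroʳ _)

  -- Linear extension over the terms of a polynomial

  extend : (Mono d n → Carrier) → Poly F d n → Carrier
  extend K []            = 0#
  extend K ((a , e) ∷ p) = a * K e + extend K p

  extend-cong : {K K′ : Mono d n → Carrier} (p : Poly F d n) → (∀ e → K e ≈ K′ e) → extend K p ≈ extend K′ p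
  extend-cong []            K≈K′ = ≈-refl
  extend-cong ((a , e) ∷ p) K≈K′ = +-cong (*-congˡ (K≈K′ e)) (extend-cong p K≈K′)

  extend-++ : (K : Mono d n → Carrier) (p q : Poly F d n) → extend K (p ++ q) ≈ extend K p + extend K q
  extend-++ K []            q = ≈-sym (+-identityˡ _)
  extend-++ K ((a , e) ∷ p) q = ≈-trans (+-congˡ (extend-++ K p q)) (≈-sym (+-assoc _ _ _))

  extend-*ˡ : (z : Carrier) (K : Mono d n → Carrier) (p : Poly F d n) → extend (λ e → z * K e) p ≈ z * extend K p
  extend-*ˡ z K []            = ≈-sym (zeroʳ z)
  extend-*ˡ z K ((a , e) ∷ p) = begin
    a * (z * K e) + extend (λ e → z * K e) p  ≈⟨ +-cong (x∙yz≈y∙xz a z (K e)) (extend-*ˡ z K p) ⟩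
    z * (a * K e) + z * extend K p            ≈⟨ distribˡ z _ _ ⟨
    z * (a * K e + extend K p)                ∎

  extend-*ʳ : (z : Carrier) (K : Mono d n → Carrier) (p : Poly F d n) → extend (λ e → K e * z) p ≈ extend K p * z
  extend-*ʳ z K p = begin
    extend (λ e → K e * z) p  ≈⟨ extend-cong p (λ e → *-comm (K e) z) ⟩
    extend (λ e → z * K e) p  ≈⟨ extend-*ˡ z K p ⟩
    z * extend K p            ≈⟨ *-comm z _ ⟩
    extend K p * z            ∎

  extend-sum : (K : Mono d n → Fin k → Carrier) (p : Poly F d n) →
               extend (λ e → sum (K e)) p ≈ sum (λ s → extend (λ e → K e s) p)
  extend-sum {k = k} K [] = ≈-sym (sum-replicate-zero k)
  extend-sum {d = d} {n = n} {k = k} K ((a , e) ∷ p) = begin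
    a * sum (K e) + extend (λ e → sum (K e)) p            ≈⟨ +-cong (*-distribˡ-sum a (K e)) (extend-sum K p) ⟩
    sum (λ s → a * K e s) + sum (λ s → extend (K′ s) p)   ≈⟨ ∑-distrib-+ (λ s → a * K e s) (λ s → extend (K′ s) p) ⟨
    sum (λ s → a * K e s + extend (K′ s) p)               ∎
    where
    K′ : Fin k → Mono d n → Carrier
    K′ s e = K e s

  -- ψ stands for the term map inside _·ₚ_, a pattern-matching lambda that cannot be named here.
  extend-map-scale : (K : Mono d n → Carrier) (a : Carrier) (e₁ : Mono d n)
                     (ψ : Carrier × Mono d n → Carrier × Mono d n) → (∀ b e₂ → ψ (b , e₂) ≡ (a * b , e₁ ·ₘ e₂)) →
                     (q : Poly F d n) → extend K (map ψ q) ≈ a * extend (λ e₂ → K (e₁ ·ₘ e₂)) q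
  extend-map-scale K a e₁ ψ ψ≡ []             = ≈-sym (zeroʳ a)
  extend-map-scale {d = d} {n = n} K a e₁ ψ ψ≡ ((b , e₂) ∷ q) rewrite ψ≡ b e₂ = begin
    a * b * K (e₁ ·ₘ e₂) + extend K (map ψ q)     ≈⟨ +-cong (*-assoc a b _) (extend-map-scale K a e₁ ψ ψ≡ q) ⟩
    a * (b * K (e₁ ·ₘ e₂)) + a * extend K₁ q      ≈⟨ distribˡ a _ _ ⟨
    a * (b * K (e₁ ·ₘ e₂) + extend K₁ q)          ∎
    where
    K₁ : Mono d n → Carrier
    K₁ e₂ = K (e₁ ·ₘ e₂)

  extend-·ₚ : (K : Mono d n → Carrier) (p q : Poly F d n) →
              extend K (_·ₚ_ F p q) ≈ extend (λ e₁ → extend (λ e₂ → K (e₁ ·ₘ e₂)) q) p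
  extend-·ₚ K []             q = ≈-refl
  extend-·ₚ K ((a , e₁) ∷ p) q = begin
    extend K (map _ q ++ _·ₚ_ F p q)
      ≈⟨ extend-++ K (map _ q) _ ⟩
    extend K (map _ q) + extend K (_·ₚ_ F p q)
      ≈⟨ +-cong (extend-map-scale K a e₁ _ (λ _ _ → refl) q) (extend-·ₚ K p q) ⟩
    a * extend (λ e₂ → K (e₁ ·ₘ e₂)) q + extend (λ e₁ → extend (λ e₂ → K (e₁ ·ₘ e₂)) q) p
      ∎

  δ : Mono d n → Mono d n → Carrier
  δ x e = 𝟙 (x ≟ₘ e)

  coeff≈extend-δ : (p : Poly F d n) (x : Mono d n) → coeff F p x ≈ extend (δ x) p
  coeff≈extend-δ []            x = ≈-refl
  coeff≈extend-δ ((a , e) ∷ p) x with x ≟ₘ e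
  ... | yes _ = +-cong (≈-sym (*-identityʳ a)) (coeff≈extend-δ p x)
  ... | no  _ = ≈-trans (coeff≈extend-δ p x) (≈-sym (≈-trans (+-congʳ (zeroʳ a)) (+-identityˡ _)))

  without : Mono d n → Poly F d n → Poly F d n
  without x []            = []
  without x ((a , e) ∷ p) with x ≟ₘ e
  ... | yes _ = without x p
  ... | no  _ = (a , e) ∷ without x p

  length-without : (x : Mono d n) (p : Poly F d n) → length (without x p) ℕ.≤ length p
  length-without x []            = ℕ.z≤n
  length-without x ((a , e) ∷ p) with x ≟ₘ e
  ... | yes _ = m≤n⇒m≤1+n (length-without x p)
  ... | no  _ = ℕ.s≤s (length-without x p)

  length-without-head : (a : Carrier) (x : Mono d n) (p : Poly F d n) →
                        length (without x ((a , x) ∷ p)) ℕ.< length ((a , x) ∷ p)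
  length-without-head a x p with x ≟ₘ x
  ... | yes _   = ℕ.s≤s (length-without x p)
  ... | no  x≢x = contradiction refl x≢x

  extend-without : (K : Mono d n → Carrier) (x : Mono d n) (p : Poly F d n) →
                   extend K p ≈ coeff F p x * K x + extend K (without x p)
  extend-without K x []            = ≈-sym (≈-trans (+-congʳ (zeroˡ (K x))) (+-identityˡ 0#))
  extend-without K x ((a , e) ∷ p) with x ≟ₘ e
  ... | yes refl = begin
    a * K x + extend K p                                          ≈⟨ +-congˡ (extend-without K x p) ⟩
    a * K x + (coeff F p x * K x + extend K (without x p))        ≈⟨ +-assoc _ _ _ ⟨
    a * K x + coeff F p x * K x + extend K (without x p)          ≈⟨ +-congʳ (distribʳ (K x) a _) ⟨
    (a + coeff F p x) * K x + extend K (without x p)              ∎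
  ... | no _ = ≈-trans (+-congˡ (extend-without K x p)) (x+[y+z]≈y+[x+z] _ _ _)

  coeff-without-≢ : {x y : Mono d n} (p : Poly F d n) → x ≢ y → coeff F (without x p) y ≈ coeff F p y
  coeff-without-≢             []            _   = ≈-refl
  coeff-without-≢ {x = x} {y} ((a , e) ∷ p) x≢y with x ≟ₘ e
  ... | yes refl with y ≟ₘ x
  ...   | yes refl = contradiction refl x≢y
  ...   | no  _    = coeff-without-≢ p x≢y
  coeff-without-≢ {x = x} {y} ((a , e) ∷ p) x≢y | no _ with y ≟ₘ e
  ...   | yes _ = +-congˡ (coeff-without-≢ p x≢y)
  ...   | no  _ = coeff-without-≢ p x≢y

  coeff-without-self : (x : Mono d n) (p : Poly F d n) → coeff F (without x p) x ≈ 0#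
  coeff-without-self x []            = ≈-refl
  coeff-without-self x ((a , e) ∷ p) with x ≟ₘ e
  ... | yes _ = coeff-without-self x p
  ... | no x≢e with x ≟ₘ e
  ...   | yes x≡e = contradiction x≡e x≢e
  ...   | no  _   = coeff-without-self x p

  -- Stated under ¬ ¬ because whether a coefficient vanishes is not decidable.
  extend-cong-support : {K K′ : Mono d n → Carrier} (p : Poly F d n) →
                        (∀ e → ¬ coeff F p e ≈ 0# → ¬ ¬ K e ≈ K′ e) → ¬ ¬ extend K p ≈ extend K′ p
  extend-cong-support {d = d} {n} {K} {K′} p = go p (wellFounded length <-wellFounded p)
    where
    go : (p : Poly F d n) → Acc (ℕ._<_ on length) p →
         (∀ e → ¬ coeff F p e ≈ 0# → ¬ ¬ K e ≈ K′ e) → ¬ ¬ extend K p ≈ extend K′ p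
    go []                   _         _     = pure ≈-refl
    go p@((a , x) ∷ p′) (acc rec) agree = do
      leading ← leading-term
      rest    ← go (without x p) (rec (length-without-head a x p′)) agree-without
      pure (begin
        extend K p                                    ≈⟨ extend-without K x p ⟩
        coeff F p x * K x + extend K (without x p)    ≈⟨ +-cong leading rest ⟩
        coeff F p x * K′ x + extend K′ (without x p)  ≈⟨ extend-without K′ x p ⟨
        extend K′ p                                   ∎)
      where
      leading-term : ¬ ¬ coeff F p x * K x ≈ coeff F p x * K′ x
      leading-term = ¬¬-excluded-middle >>= λ where
        (yes c≈0) → pure (≈-trans (*-congʳ c≈0) (≈-trans (zeroˡ _) (≈-sym (≈-trans (*-congʳ c≈0) (zeroˡ _)))))
        (no  c≉0) → *-congˡ <$> agree x c≉0
      agree-without : ∀ e → ¬ coeff F (without x p) e ≈ 0# → ¬ ¬ K e ≈ K′ e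
      agree-without e c′≉0 with x ≟ₘ e
      ... | yes refl = contradiction (coeff-without-self x p) c′≉0
      ... | no  x≢e  = agree e (c′≉0 ∘ ≈-trans (coeff-without-≢ p x≢e))

  -- Coefficients of products of set-multilinear polynomials

  HomSetMultilinear⇒restrict≡ : {S : Subset d} (p : Poly F d n) → HomSetMultilinear F S p →
                                ∀ {e} → ¬ coeff F p e ≈ 0# → restrict S e ≡ e
  HomSetMultilinear⇒restrict≡ {S = S} p p-sml {e} c≉0 =
    SetMultilinear⇒restrict≡ S e (SetMultilinearMono⇒SetMultilinear S e (p-sml e c≉0))

  δ-·ₘ : {S T : Subset d} → S ∩ T ≡ ⊥ → S ∪ T ≡ ⊤ → {e e₁ e₂ : Mono d n} →
         restrict S e₁ ≡ e₁ → restrict T e₂ ≡ e₂ → δ e (e₁ ·ₘ e₂) ≈ δ (restrict S e) e₁ * δ (restrict T e) e₂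
  δ-·ₘ {S = S} {T} S∩T≡⊥ S∪T≡⊤ {e} {e₁} {e₂} e₁-on-S e₂-on-T =
    𝟙-⇔× (·ₘ-restrict-⇔ S∩T≡⊥ S∪T≡⊤ e₁-on-S e₂-on-T) (e ≟ₘ (e₁ ·ₘ e₂)) (restrict S e ≟ₘ e₁) (restrict T e ≟ₘ e₂)

  coeff-·ₚ : {Sf Sg : Subset d} → Sf ∩ Sg ≡ ⊥ → Sf ∪ Sg ≡ ⊤ → (p q : Poly F d n) →
             HomSetMultilinear F Sf p → HomSetMultilinear F Sg q →
             ∀ e → ¬ ¬ coeff F (_·ₚ_ F p q) e ≈ coeff F p (restrict Sf e) * coeff F q (restrict Sg e)
  coeff-·ₚ {d = d} {n = n} {Sf = Sf} {Sg} Sf∩Sg≡⊥ Sf∪Sg≡⊤ p q p-sml q-sml e = do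
    factorised ← extend-cong-support p λ e₁ c₁≉0 → extend-cong-support q λ e₂ c₂≉0 →
      pure (δ-·ₘ Sf∩Sg≡⊥ Sf∪Sg≡⊤ (HomSetMultilinear⇒restrict≡ p p-sml c₁≉0) (HomSetMultilinear⇒restrict≡ q q-sml c₂≉0))
    pure (begin
      coeff F (_·ₚ_ F p q) e                                   ≈⟨ coeff≈extend-δ (_·ₚ_ F p q) e ⟩
      extend (δ e) (_·ₚ_ F p q)                                ≈⟨ extend-·ₚ (δ e) p q ⟩
      extend (λ e₁ → extend (λ e₂ → δ e (e₁ ·ₘ e₂)) q) p       ≈⟨ factorised ⟩
      extend (λ e₁ → extend (λ e₂ → δ eᶠ e₁ * δ eᵍ e₂) q) p    ≈⟨ extend-cong p (λ e₁ → extend-*ˡ (δ eᶠ e₁) (δ eᵍ) q) ⟩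
      extend (λ e₁ → δ eᶠ e₁ * extend (δ eᵍ) q) p              ≈⟨ extend-*ʳ (extend (δ eᵍ) q) (δ eᶠ) p ⟩
      extend (δ eᶠ) p * extend (δ eᵍ) q                        ≈⟨ *-cong (coeff≈extend-δ p eᶠ) (coeff≈extend-δ q eᵍ) ⟨
      coeff F p eᶠ * coeff F q eᵍ                              ∎)
    where
    eᶠ eᵍ : Mono d n
    eᶠ = restrict Sf e
    eᵍ = restrict Sg e

  onBasis : (S : Subset d) → Fin (n ^ ∣ S ∣) → Mono d n → Carrier
  onBasis S s x = 𝟙 (coordinate S x ≟ᴹ just s)

  coeff≈coordinate : {S : Subset d} (p : Poly F d n) → HomSetMultilinear F S p →
                     ∀ x → ¬ ¬ coeff F p x ≈ maybe′ (coeff F p ∘ basis S) 0# (coordinate S x)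
  coeff≈coordinate {S = S} p p-sml x with setMultilinear? S x
  ... | yes sm = pure (reflexive (cong (coeff F p) (≡.sym (basis-index S x sm))))
  ... | no ¬sm = λ c≉0 → ¬sm (SetMultilinearMono⇒SetMultilinear S x (p-sml x c≉0))

  coeff-basis-expansion : {S : Subset d} (p : Poly F d n) → HomSetMultilinear F S p →
                          ∀ x → ¬ ¬ coeff F p x ≈ sum (λ s → coeff F p (basis S s) * onBasis S s x)
  coeff-basis-expansion {S = S} p p-sml x =
    (λ c≈ → ≈-trans c≈ (≈-sym (sum-𝟙-just (coeff F p ∘ basis S) (coordinate S x)))) <$> coeff≈coordinate p p-sml x

  -- Independent vectors and rank

  linIndep-image : ∀ {k m N} (P : Fin m → Fin N → Carrier) (v : Fin k → Fin N → Carrier) (w : Fin k → Fin m → Carrier) →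
                   (∀ j i → w j i ≈ sum (λ s → P i s * v j s)) → LinIndep F w → LinIndep F v
  linIndep-image P v w w≈Pv w-indep λs λv≈0 = w-indep λs λw≈0
    where
    λw≈0 : ∀ i → ∑ F (λ j → λs j * w j i) ≈ 0#
    λw≈0 i = begin
      ∑ F (λ j → λs j * w j i)
        ≈⟨ ∑≈sum (λ j → λs j * w j i) ⟩
      sum (λ j → λs j * w j i)
        ≈⟨ sum-cong-≋ (λ j → *-congˡ (w≈Pv j i)) ⟩
      sum (λ j → λs j * sum (λ s → P i s * v j s))
        ≈⟨ sum-cong-≋ (λ j → *-distribˡ-sum (λs j) (λ s → P i s * v j s)) ⟩
      sum (λ j → sum (λ s → λs j * (P i s * v j s)))
        ≈⟨ ∑-comm (λ j s → λs j * (P i s * v j s)) ⟩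
      sum (λ s → sum (λ j → λs j * (P i s * v j s)))
        ≈⟨ sum-cong-≋ (λ s → sum-cong-≋ (λ j → x∙yz≈y∙xz (λs j) (P i s) (v j s))) ⟩
      sum (λ s → sum (λ j → P i s * (λs j * v j s)))
        ≈⟨ sum-cong-≋ (λ s → *-distribˡ-sum (P i s) (λ j → λs j * v j s)) ⟨
      sum (λ s → P i s * sum (λ j → λs j * v j s))
        ≈⟨ sum-zero (λ s → ≈-trans (*-congˡ (λv≈0′ s)) (zeroʳ (P i s))) ⟩
      0#
        ∎
      where
      λv≈0′ : ∀ s → sum (λ j → λs j * v j s) ≈ 0#
      λv≈0′ s = ≈-trans (≈-sym (∑≈sum (λ j → λs j * v j s))) (λv≈0 s)

  head-zero⇒¬linIndep : ∀ {k N} (w : Fin (ℕ.suc k) → Fin N → Carrier) → (∀ i → w zero i ≈ 0#) → ¬ LinIndep F w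
  head-zero⇒¬linIndep {k} w w₀≈0 w-indep = 0≉1 (≈-sym (w-indep λs relation zero))
    where
    λs : Fin (ℕ.suc k) → Carrier
    λs zero    = 1#
    λs (suc _) = 0#
    relation : ∀ i → ∑ F (λ j → λs j * w j i) ≈ 0#
    relation i = begin
      1# * w zero i + ∑ F (λ j → 0# * w (suc j) i)  ≈⟨ +-cong (≈-trans (*-identityˡ _) (w₀≈0 i)) rest≈0 ⟩
      0# + 0#                                       ≈⟨ +-identityʳ 0# ⟩
      0#                                            ∎
      where
      rest≈0 : ∑ F (λ j → 0# * w (suc j) i) ≈ 0#
      rest≈0 = ≈-trans (∑≈sum (λ j → 0# * w (suc j) i)) (sum-zero (λ j → zeroˡ (w (suc j) i)))

  -- One step of Gaussian elimination: clear coordinate i₀ with the pivot vector w zero, then drop coordinate i₀.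
  module Elimination {k N} (w : Fin (ℕ.suc k) → Fin (ℕ.suc N) → Carrier) (i₀ : Fin (ℕ.suc N))
                     (w₀≉0 : ¬ w zero i₀ ≈ 0#) where

    w₀⁻¹ : Carrier
    w₀⁻¹ = proj₁ (inverse (w zero i₀) w₀≉0)

    w₀w₀⁻¹≈1 : w zero i₀ * w₀⁻¹ ≈ 1#
    w₀w₀⁻¹≈1 = proj₂ (inverse (w zero i₀) w₀≉0)

    multiplier : Fin k → Carrier
    multiplier j = w (suc j) i₀ * w₀⁻¹

    cleared : Fin k → Fin (ℕ.suc N) → Carrier
    cleared j i = w (suc j) i - multiplier j * w zero i

    cleared-pivot : ∀ j → cleared j i₀ ≈ 0#
    cleared-pivot j = begin
      w (suc j) i₀ - w (suc j) i₀ * w₀⁻¹ * w zero i₀     ≈⟨ +-congˡ (-‿cong (*-assoc _ _ _)) ⟩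
      w (suc j) i₀ - w (suc j) i₀ * (w₀⁻¹ * w zero i₀)   ≈⟨ +-congˡ (-‿cong (*-congˡ (≈-trans (*-comm _ _) w₀w₀⁻¹≈1))) ⟩
      w (suc j) i₀ - w (suc j) i₀ * 1#                   ≈⟨ +-congˡ (-‿cong (*-identityʳ _)) ⟩
      w (suc j) i₀ - w (suc j) i₀                        ≈⟨ -‿inverseʳ _ ⟩
      0#                                                 ∎

    reduced : Fin k → Fin N → Carrier
    reduced j i = cleared j (punchIn i₀ i)

    -- A relation μ among the cleared vectors is the relation lift μ among the original ones.
    lift : (Fin k → Carrier) → Fin (ℕ.suc k) → Carrier
    lift μ zero    = - sum (λ j → μ j * multiplier j)
    lift μ (suc j) = μ j

    lift-relation : ∀ μ i → ∑ F (λ j → lift μ j * w j i) ≈ sum (λ j → μ j * cleared j i)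
    lift-relation μ i = begin
      (- M) * w zero i + ∑ F a
        ≈⟨ +-cong (≈-trans (≈-sym (-‿distribˡ-* M _)) (-‿distribʳ-* M _)) (∑≈sum a) ⟩
      M * (- w zero i) + sum a
        ≈⟨ +-comm _ _ ⟩
      sum a + M * (- w zero i)
        ≈⟨ +-congˡ (*-distribʳ-sum (- w zero i) (λ j → μ j * multiplier j)) ⟩
      sum a + sum b
        ≈⟨ ∑-distrib-+ a b ⟨
      sum (λ j → a j + b j)
        ≈⟨ sum-cong-≋ (λ j → ≈-sym (scaled-difference (μ j) _ _ _)) ⟩
      sum (λ j → μ j * cleared j i)
        ∎
      where
      M : Carrier
      M = sum (λ j → μ j * multiplier j)
      a b : Fin k → Carrier
      a j = μ j * w (suc j) i
      b j = μ j * multiplier j * (- w zero i)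
      scaled-difference : ∀ a x y z → a * (x - y * z) ≈ a * x + a * y * (- z)
      scaled-difference a x y z = begin
        a * (x - y * z)          ≈⟨ distribˡ a x _ ⟩
        a * x + a * - (y * z)    ≈⟨ +-congˡ (-‿distribʳ-* a _) ⟨
        a * x + - (a * (y * z))  ≈⟨ +-congˡ (-‿cong (*-assoc a y z)) ⟨
        a * x + - (a * y * z)    ≈⟨ +-congˡ (-‿distribʳ-* (a * y) z) ⟩
        a * x + a * y * (- z)    ∎

    reduced-linIndep : LinIndep F w → LinIndep F reduced
    reduced-linIndep w-indep μ μ-relation j =
      w-indep (lift μ) (λ i → ≈-trans (lift-relation μ i) (cleared-relation i)) (suc j)
      where
      cleared-relation : ∀ i → sum (λ j → μ j * cleared j i) ≈ 0#
      cleared-relation i with i₀ ≟ᶠ i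
      ... | yes refl = sum-zero (λ j → ≈-trans (*-congˡ (cleared-pivot j)) (zeroʳ (μ j)))
      ... | no i₀≢i  = ≡.subst (λ i → sum (λ j → μ j * cleared j i) ≈ 0#) (punchIn-punchOut i₀≢i)
                         (≈-trans (≈-sym (∑≈sum (λ j → μ j * reduced j (punchOut i₀≢i)))) (μ-relation (punchOut i₀≢i)))

  linIndep⇒≤ : ∀ {k N} (w : Fin k → Fin N → Carrier) → LinIndep F w → k ℕ.≤ N
  linIndep⇒≤ {ℕ.zero}              _ _       = ℕ.z≤n
  linIndep⇒≤ {ℕ.suc k} {ℕ.zero}    w w-indep = contradiction (≈-sym (w-indep (λ _ → 1#) (λ ()) zero)) 0≉1
  -- k ≤ N is decidable, hence stable under ¬ ¬, so a pivot may be chosen without deciding which entries vanish.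
  linIndep⇒≤ {ℕ.suc k} {ℕ.suc N}   w w-indep = decidable-stable (ℕ.suc k ℕ.≤? ℕ.suc N) λ k≰N →
    ¬¬-∀Fin (λ i₀ w₀≉0 → let open Elimination w i₀ w₀≉0 in
                          k≰N (ℕ.s≤s (linIndep⇒≤ reduced (reduced-linIndep w-indep))))
            (λ w₀≈0 → head-zero⇒¬linIndep w w₀≈0 w-indep)

  rankLe-factorisation : ∀ {m N} (A : Matrix F m) (P : Fin m → Fin N → Carrier) (Q : Fin N → Fin m → Carrier) →
                         ¬ ¬ (∀ i j → A i j ≈ sum (λ s → P i s * Q s j)) → RankLe F A N
  rankLe-factorisation {N = N} A P Q A≈PQ σ columns-indep = A≈PQ λ A≈PQ′ →
    n≮n N (linIndep⇒≤ (λ j s → Q s (σ j)) (linIndep-image P _ _ (λ j i → A≈PQ′ i (σ j)) columns-indep))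

  -- φ stands for the pattern-matching lambda inside InCoeffSpace.
  foldr≡extend : (K : Mono d n → Carrier) (φ : Carrier × Mono d n → Carrier → Carrier) →
                 (∀ a e s → φ (a , e) s ≡ a * K e + s) → (ts : Poly F d n) → foldr φ 0# ts ≡ extend K ts
  foldr≡extend K φ φ≡ []             = refl
  foldr≡extend K φ φ≡ ((a , e) ∷ ts) = ≡.trans (φ≡ a e _) (cong (a * K e +_) (foldr≡extend K φ φ≡ ts))

  coeffSpace-entry : ∀ {m} (M : Fin m → Fin m → Poly F d n) (A : Matrix F m) (A∈ : InCoeffSpace F M A) →
                     ∀ i j → A i j ≈ extend (λ e → coeffMatrix F M e i j) (proj₁ A∈)
  coeffSpace-entry M A (ts , A≈) i j = ≈-trans (A≈ i j) (reflexive (foldr≡extend _ _ (λ _ _ _ → refl) ts))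

  extend-sum-*ˡ : (u : Fin k → Carrier) (W : Fin k → Mono d n → Carrier) (ts : Poly F d n) →
                  extend (λ e → sum (λ s → u s * W s e)) ts ≈ sum (λ s → u s * extend (W s) ts)
  extend-sum-*ˡ u W ts = ≈-trans (extend-sum (λ e s → u s * W s e) ts) (sum-cong-≋ λ s → extend-*ˡ (u s) (W s) ts)

  extend-sum-*ʳ : (u : Fin k → Carrier) (W : Fin k → Mono d n → Carrier) (ts : Poly F d n) →
                  extend (λ e → sum (λ s → W s e * u s)) ts ≈ sum (λ s → extend (W s) ts * u s)
  extend-sum-*ʳ u W ts = ≈-trans (extend-sum (λ e s → W s e * u s) ts) (sum-cong-≋ λ s → extend-*ʳ (u s) (W s) ts)

  module _ {Sf Sg : Subset d} (Sf∩Sg≡⊥ : Sf ∩ Sg ≡ ⊥) (Sf∪Sg≡⊤ : Sf ∪ Sg ≡ ⊤) (p q : Poly F d n)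
           (p-sml : HomSetMultilinear F Sf p) (q-sml : HomSetMultilinear F Sg q) where

    coeff-·ₚ-expandˡ : ∀ e → ¬ ¬ coeff F (_·ₚ_ F p q) e ≈
                       sum (λ s → coeff F p (basis Sf s) * (onBasis Sf s (restrict Sf e) * coeff F q (restrict Sg e)))
    coeff-·ₚ-expandˡ e = do
      split     ← coeff-·ₚ Sf∩Sg≡⊥ Sf∪Sg≡⊤ p q p-sml q-sml e
      expansion ← coeff-basis-expansion p p-sml (restrict Sf e)
      pure (begin
        coeff F (_·ₚ_ F p q) e       ≈⟨ split ⟩
        coeff F p (restrict Sf e) * qᵍ  ≈⟨ *-congʳ expansion ⟩
        sum (λ s → b s * χ s) * qᵍ    ≈⟨ *-distribʳ-sum qᵍ (λ s → b s * χ s) ⟩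
        sum (λ s → b s * χ s * qᵍ)    ≈⟨ sum-cong-≋ (λ s → *-assoc (b s) (χ s) qᵍ) ⟩
        sum (λ s → b s * (χ s * qᵍ))  ∎)
      where
      b χ : Fin (n ^ ∣ Sf ∣) → Carrier
      b s = coeff F p (basis Sf s)
      χ s = onBasis Sf s (restrict Sf e)
      qᵍ : Carrier
      qᵍ = coeff F q (restrict Sg e)

    coeff-·ₚ-expandʳ : ∀ e → ¬ ¬ coeff F (_·ₚ_ F p q) e ≈
                       sum (λ s → coeff F p (restrict Sf e) * onBasis Sg s (restrict Sg e) * coeff F q (basis Sg s))
    coeff-·ₚ-expandʳ e = do
      split     ← coeff-·ₚ Sf∩Sg≡⊥ Sf∪Sg≡⊤ p q p-sml q-sml e
      expansion ← coeff-basis-expansion q q-sml (restrict Sg e)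
      pure (begin
        coeff F (_·ₚ_ F p q) e         ≈⟨ split ⟩
        pᶠ * coeff F q (restrict Sg e)  ≈⟨ *-congˡ expansion ⟩
        pᶠ * sum (λ s → b s * χ s)      ≈⟨ *-distribˡ-sum pᶠ (λ s → b s * χ s) ⟩
        sum (λ s → pᶠ * (b s * χ s))    ≈⟨ sum-cong-≋ (λ s → x∙yz≈xz∙y pᶠ (b s) (χ s)) ⟩
        sum (λ s → pᶠ * χ s * b s)      ∎)
      where
      b χ : Fin (n ^ ∣ Sg ∣) → Carrier
      b s = coeff F q (basis Sg s)
      χ s = onBasis Sg s (restrict Sg e)
      pᶠ : Carrier
      pᶠ = coeff F p (restrict Sf e)

  module _ {m} {Sf Sg : Subset d} (Sf∩Sg≡⊥ : Sf ∩ Sg ≡ ⊥) (Sf∪Sg≡⊤ : Sf ∪ Sg ≡ ⊤) (f g : Fin m → Poly F d n)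
           (f-sml : ∀ i → HomSetMultilinear F Sf (f i)) (g-sml : ∀ i → HomSetMultilinear F Sg (g i)) where

    rankLe-Sf : CoeffSpaceRankLe F (_⊗_ F f g) (n ^ ∣ Sf ∣)
    rankLe-Sf A A∈ = rankLe-factorisation A P Q (¬¬-∀Fin λ i → ¬¬-∀Fin λ j → entry i j)
      where
      ts : Poly F d n
      ts = proj₁ A∈
      P : Fin m → Fin (n ^ ∣ Sf ∣) → Carrier
      P i s = coeff F (f i) (basis Sf s)
      W : Fin m → Fin (n ^ ∣ Sf ∣) → Mono d n → Carrier
      W j s e = onBasis Sf s (restrict Sf e) * coeff F (g j) (restrict Sg e)
      Q : Fin (n ^ ∣ Sf ∣) → Fin m → Carrier
      Q s j = extend (W j s) ts
      entry : ∀ i j → ¬ ¬ A i j ≈ sum (λ s → P i s * Q s j)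
      entry i j = do
        expanded ← extend-cong-support ts λ e _ → coeff-·ₚ-expandˡ Sf∩Sg≡⊥ Sf∪Sg≡⊤ (f i) (g j) (f-sml i) (g-sml j) e
        pure (begin
          A i j                                          ≈⟨ coeffSpace-entry (_⊗_ F f g) A A∈ i j ⟩
          extend (coeff F (_·ₚ_ F (f i) (g j))) ts       ≈⟨ expanded ⟩
          extend (λ e → sum (λ s → P i s * W j s e)) ts  ≈⟨ extend-sum-*ˡ (P i) (W j) ts ⟩
          sum (λ s → P i s * Q s j)                      ∎)

    rankLe-Sg : CoeffSpaceRankLe F (_⊗_ F f g) (n ^ ∣ Sg ∣)
    rankLe-Sg A A∈ = rankLe-factorisation A P Q (¬¬-∀Fin λ i → ¬¬-∀Fin λ j → entry i j)
      where
      ts : Poly F d n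
      ts = proj₁ A∈
      W : Fin m → Fin (n ^ ∣ Sg ∣) → Mono d n → Carrier
      W i s e = coeff F (f i) (restrict Sf e) * onBasis Sg s (restrict Sg e)
      P : Fin m → Fin (n ^ ∣ Sg ∣) → Carrier
      P i s = extend (W i s) ts
      Q : Fin (n ^ ∣ Sg ∣) → Fin m → Carrier
      Q s j = coeff F (g j) (basis Sg s)
      entry : ∀ i j → ¬ ¬ A i j ≈ sum (λ s → P i s * Q s j)
      entry i j = do
        expanded ← extend-cong-support ts λ e _ → coeff-·ₚ-expandʳ Sf∩Sg≡⊥ Sf∪Sg≡⊤ (f i) (g j) (f-sml i) (g-sml j) e
        pure (begin
          A i j                                          ≈⟨ coeffSpace-entry (_⊗_ F f g) A A∈ i j ⟩
          extend (coeff F (_·ₚ_ F (f i) (g j))) ts       ≈⟨ expanded ⟩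
          extend (λ e → sum (λ s → W i s e * Q s j)) ts  ≈⟨ extend-sum-*ʳ (λ s → Q s j) (W i) ts ⟩
          sum (λ s → P i s * Q s j)                      ∎)

mainTheorem7 : ∀ {c ℓ} (F : Field c ℓ) (n d m : ℕ) (Sf Sg : Subset d) →
    Sf ∩ Sg ≡ ⊥ → Sf ∪ Sg ≡ ⊤ →
    (f g : Fin m → Poly F d n) →
    (∀ i → HomSetMultilinear F Sf (f i)) →
    (∀ i → HomSetMultilinear F Sg (g i)) →
    CoeffSpaceRankLe F (_⊗_ F f g) ((n ^ ∣ Sf ∣) ⊓ (n ^ ∣ Sg ∣))
mainTheorem7 F n d m Sf Sg Sf∩Sg≡⊥ Sf∪Sg≡⊤ f g f-sml g-sml with ⊓-sel (n ^ ∣ Sf ∣) (n ^ ∣ Sg ∣)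
... | inj₁ min≡Sf rewrite min≡Sf = rankLe-Sf F Sf∩Sg≡⊥ Sf∪Sg≡⊤ f g f-sml g-sml
... | inj₂ min≡Sg rewrite min≡Sg = rankLe-Sg F Sf∩Sg≡⊥ Sf∪Sg≡⊤ f g f-sml g-sml
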